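{- If $r\ge 1$ is an integer and $A\subseteq\mathbb{F}_2^r$ is a round set, then $|D(A)|\ge\frac12|A|$.
   Context: $\mathbb{F}_2^r$ denotes the elementary abelian $2$-group of rank $r$. For $X\subseteq\mathbb{F}_2^r$, $2X:=\{x_1+x_2\colon x_1,x_2\in X\}$ (with $x_1=x_2$ allowed). A set $A$ is round if $2B\ne 2A$ for every proper subset $B\subsetneq A$. $D(A)$ is the set of elements of $\mathbb{F}_2^r$ having exactly one representation, up to the order of summands, as $a_1+a_2$ with $a_1,a_2\in A$. -}

module Defs where

open import Data.Bool using (Bool; _xor_)
open import Data.Nat using (ℕ; _*_; _≤_)
open import Data.Vec using (Vec; zipWith)
open import Data.List using (List; length)
open import Data.List.Membership.Propositional using (_∈_; _∉_)
open import Data.List.Relation.Unary.Unique.Propositional using (Unique)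
open import Data.Product using (Σ; ∃; _×_; _,_)
open import Data.Sum using (_⊎_)
open import Relation.Binary.PropositionalEquality using (_≡_)
open import Relation.Nullary using (¬_)
open import Function.Bundles using (_⇔_)

F2^ : ℕ → Set
F2^ r = Vec Bool r

_⊕_ : ∀ {r} → F2^ r → F2^ r → F2^ r
_⊕_ = zipWith _xor_

-- A finite subset of F₂^r is represented by a duplicate-free list;
-- its cardinality is the length of the list.
-- Membership in the sumset 2X = {x₁ + x₂ : x₁, x₂ ∈ X} (x₁ = x₂ allowed).
_∈2_ : ∀ {r} → F2^ r → List (F2^ r) → Set
y ∈2 X = Σ _ λ x₁ → Σ _ λ x₂ → x₁ ∈ X × x₂ ∈ X × x₁ ⊕ x₂ ≡ y

_⊂_ : ∀ {r} → List (F2^ r) → List (F2^ r) → Set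
B ⊂ A = (∀ x → x ∈ B → x ∈ A) × (Σ _ λ a → a ∈ A × a ∉ B)

Round : ∀ {r} → List (F2^ r) → Set
Round {r} A = ∀ (B : List (F2^ r)) → B ⊂ A → ¬ (∀ y → (y ∈2 B) ⇔ (y ∈2 A))

InD : ∀ {r} → List (F2^ r) → F2^ r → Set
InD A y = Σ _ λ a₁ → Σ _ λ a₂ → a₁ ∈ A × a₂ ∈ A × a₁ ⊕ a₂ ≡ y ×
  (∀ b₁ b₂ → b₁ ∈ A → b₂ ∈ A → b₁ ⊕ b₂ ≡ y →
     (b₁ ≡ a₁ × b₂ ≡ a₂) ⊎ (b₁ ≡ a₂ × b₂ ≡ a₁))

module Submission where

-- Let A ⊆ F₂^r be round and a ∈ A.  If every sum a + c (c ∈ A)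
-- could also be written as b₁ + b₂ with b₁, b₂ ∈ A ∖ {a}, then
-- 2(A ∖ {a}) = 2A, contradicting roundness.  So a has a partner c ∈ A
-- such that a + c has no representation avoiding a; by cancellation in
-- F₂^r this forces a + c ∈ D(A).  An element of D(A) has exactly two
-- summands in A, so the assignment a ↦ a + c is at most two-to-one,
-- and its image is a subset of D(A) of size at least |A|/2.

open import Defs
open import Data.Nat using (ℕ; _*_; _≤_; suc; z≤n; s≤s)
open import Data.Nat.Properties using (≤-trans; ≤-refl; ≤-reflexive; *-suc)
open import Data.Bool using (_xor_)
import Data.Bool as Bool
open import Data.Bool.Properties using (xor-assoc; xor-same; xor-comm)
open import Data.Vec using ([]; _∷_)
open import Data.Vec.Properties using (≡-dec)
open import Data.Vec.Relation.Binary.Pointwise.Inductive using (Pointwise-≡⇒≡; zipWith-comm)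
open import Data.List using (List; length; []; _∷_; filter)
open import Data.List.Properties using (length-filter; filter-all)
open import Data.List.Membership.Propositional using (_∈_; _∉_; find; lose)
open import Data.List.Membership.Propositional.Properties using (∈-filter⁺; ∈-filter⁻)
open import Data.List.Relation.Unary.Any using (Any; here; there; any?)
open import Data.List.Relation.Unary.All using (All; all?)
import Data.List.Relation.Unary.All as All
open import Data.List.Relation.Unary.All.Properties using (¬All⇒Any¬)
open import Data.List.Relation.Unary.AllPairs using ([]; _∷_)
open import Data.List.Relation.Unary.Unique.Propositional using (Unique)
open import Data.List.Relation.Unary.Unique.Propositional.Properties using (filter⁺)
open import Data.Product using (Σ; _×_; _,_; proj₁; proj₂)
open import Data.Sum using (_⊎_; inj₁; inj₂)
open import Data.Empty using (⊥-elim)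
open import Relation.Nullary using (¬_; Dec; yes; no; ¬?)
open import Relation.Nullary.Decidable using (map′)
open import Relation.Binary.Definitions using (DecidableEquality)
open import Relation.Binary.PropositionalEquality using (_≡_; refl; sym; trans; cong; cong₂; subst; module ≡-Reasoning)
open import Function using (_∘_)
open import Function.Bundles using (_⇔_; mk⇔)

⊕-comm : ∀ {r} (x y : F2^ r) → x ⊕ y ≡ y ⊕ x
⊕-comm x y = Pointwise-≡⇒≡ (zipWith-comm xor-comm x y)

⊕-selfInverse : ∀ {r} (a x : F2^ r) → a ⊕ (a ⊕ x) ≡ x
⊕-selfInverse []       []       = refl
⊕-selfInverse (a ∷ as) (x ∷ xs) =
  cong₂ _∷_ (trans (sym (xor-assoc a a x)) (cong (_xor x) (xor-same a)))
            (⊕-selfInverse as xs)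

⊕-cancelˡ : ∀ {r} (a : F2^ r) {x y : F2^ r} → a ⊕ x ≡ a ⊕ y → x ≡ y
⊕-cancelˡ a {x} {y} e = begin
  x             ≡⟨ sym (⊕-selfInverse a x) ⟩
  a ⊕ (a ⊕ x)   ≡⟨ cong (a ⊕_) e ⟩
  a ⊕ (a ⊕ y)   ≡⟨ ⊕-selfInverse a y ⟩
  y             ∎
  where open ≡-Reasoning

_≟ᵥ_ : ∀ {r} → DecidableEquality (F2^ r)
_≟ᵥ_ = ≡-dec Bool._≟_

module Removal {X : Set} (_≟_ : DecidableEquality X) where

  _without_ : List X → X → List X
  xs without c = filter (λ z → ¬? (z ≟ c)) xs

  ∈-without⁻ : ∀ xs c {z} → z ∈ xs without c → z ∈ xs × ¬ z ≡ c
  ∈-without⁻ xs c = ∈-filter⁻ (λ z → ¬? (z ≟ c))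

  without-⊆ : ∀ xs c {z} → z ∈ xs without c → z ∈ xs
  without-⊆ xs c z∈ = proj₁ (∈-without⁻ xs c z∈)

  ∈-without⁺ : ∀ {xs} c {z} → z ∈ xs → ¬ z ≡ c → z ∈ xs without c
  ∈-without⁺ c = ∈-filter⁺ (λ z → ¬? (z ≟ c))

  length-without : ∀ c xs → Unique xs → length xs ≤ suc (length (xs without c))
  length-without c []       _ = z≤n
  length-without c (x ∷ xs) (x∉xs ∷ u) with x ≟ c
  ... | yes refl = s≤s (≤-reflexive (cong length (sym (filter-all (λ z → ¬? (z ≟ c)) c∉xs))))
    where
    c∉xs : All (λ z → ¬ z ≡ c) xs
    c∉xs = All.map (λ c≢z z≡c → c≢z (sym z≡c)) x∉xs
  ... | no _ = s≤s (length-without c xs u)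

-- Say that x hits y
-- within xs when R x y holds and every z ∈ xs with R z y is x or one fixed
-- partner p.  If every element of a duplicate-free list xs hits something
-- within xs, then some duplicate-free list L of hit targets has
-- |xs| ≤ 2|L|: take the target y of the head x, discard x and its partner,
-- and recurse; y is new because everything still present misses it.
module TwoToOne {X Y : Set} (_≟_ : DecidableEquality X) (R : X → Y → Set) where
  open Removal _≟_

  HitsWithin : List X → X → Set
  HitsWithin xs x =
    Σ Y λ y → R x y × Σ X λ p → ∀ {z} → z ∈ xs → R z y → z ≡ x ⊎ z ≡ p

  Cover : List X → Set
  Cover xs = Σ (List Y) λ L → Unique L ×
    (∀ {y} → y ∈ L → Σ X λ x → x ∈ xs × R x y) × length xs ≤ 2 * length L

  hitsWithin-⊆ : ∀ {xs ys x} → (∀ {z} → z ∈ ys → z ∈ xs) →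
    HitsWithin xs x → HitsWithin ys x
  hitsWithin-⊆ ys⊆xs (y , Rxy , p , fibre) = y , Rxy , p , λ z∈ys → fibre (ys⊆xs z∈ys)

  bound-step : ∀ m n k → m ≤ suc n → n ≤ 2 * k → suc m ≤ 2 * suc k
  bound-step m n k m≤1+n n≤2k rewrite *-suc 2 k = s≤s (≤-trans m≤1+n (s≤s n≤2k))

  cover : ∀ xs → Unique xs → (∀ {x} → x ∈ xs → HitsWithin xs x) → Cover xs
  cover xs = go (length xs) xs ≤-refl
    where
    go : ∀ n xs → length xs ≤ n → Unique xs →
      (∀ {x} → x ∈ xs → HitsWithin xs x) → Cover xs
    go _       []         _         _          _    = [] , [] , (λ ()) , z≤n
    go (suc n) (x ∷ rest) (s≤s len) (x∉rest ∷ u) hits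
      with hits (here refl)
    ... | y , Rxy , p , fibre
      with go n (rest without p) (≤-trans (length-filter _ rest) len) (filter⁺ _ u)
              (λ z∈ → hitsWithin-⊆ (there ∘ without-⊆ rest p)
                                   (hits (there (without-⊆ rest p z∈))))
    ... | L , uL , hitL , lenL =
      y ∷ L , All.tabulate y∉L ∷ uL , hit , bound-step _ _ _ (length-without p rest u) lenL
      where
      y∉L : ∀ {y′} → y′ ∈ L → ¬ y ≡ y′
      y∉L y′∈L refl with hitL y′∈L
      ... | z , z∈rest′ , Rzy with ∈-without⁻ rest p z∈rest′
      ... | z∈rest , z≢p with fibre (there z∈rest) Rzy
      ... | inj₁ refl = All.lookup x∉rest z∈rest refl
      ... | inj₂ z≡p  = z≢p z≡p
      hit : ∀ {y′} → y′ ∈ y ∷ L → Σ X λ z → z ∈ x ∷ rest × R z y′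
      hit (here refl) = x , here refl , Rxy
      hit (there y′∈L) with hitL y′∈L
      ... | z , z∈rest′ , Rzy′ = z , there (without-⊆ rest p z∈rest′) , Rzy′

SummandOfD : ∀ {r} → List (F2^ r) → F2^ r → F2^ r → Set
SummandOfD A a y = InD A y × Σ _ λ c → c ∈ A × a ⊕ c ≡ y

module _ {r : ℕ} where
  open Removal (_≟ᵥ_ {r})

  _∈2?_ : (y : F2^ r) (X : List (F2^ r)) → Dec (y ∈2 X)
  y ∈2? X = map′ fromAny toAny (any? (λ x₁ → any? (λ x₂ → (x₁ ⊕ x₂) ≟ᵥ y) X) X)
    where
    SumWitness : Set
    SumWitness = Any (λ x₁ → Any (λ x₂ → x₁ ⊕ x₂ ≡ y) X) X
    fromAny : SumWitness → y ∈2 X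
    fromAny w with find w
    ... | x₁ , x₁∈X , w₂ with find w₂
    ... | x₂ , x₂∈X , e = x₁ , x₂ , x₁∈X , x₂∈X , e
    toAny : y ∈2 X → SumWitness
    toAny (x₁ , x₂ , x₁∈X , x₂∈X , e) = lose x₁∈X (lose x₂∈X e)

  summand-of-InD : ∀ {A : List (F2^ r)} {y a c z z′ : F2^ r} → InD A y → a ∈ A → c ∈ A → a ⊕ c ≡ y →
    z ∈ A → z′ ∈ A → z ⊕ z′ ≡ y → z ≡ a ⊎ z ≡ c
  summand-of-InD (_ , _ , _ , _ , _ , unique) a∈A c∈A e z∈A z′∈A e′
    with unique _ _ a∈A c∈A e | unique _ _ z∈A z′∈A e′
  ... | inj₁ (refl , refl) | inj₁ (refl , _) = inj₁ refl
  ... | inj₁ (refl , refl) | inj₂ (refl , _) = inj₂ refl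
  ... | inj₂ (refl , refl) | inj₁ (refl , _) = inj₂ refl
  ... | inj₂ (refl , refl) | inj₂ (refl , _) = inj₁ refl

  -- If a + c has no representation by summands other than a, then every
  -- representation is a + c itself (by cancellation), so a + c ∈ D(A).
  avoiding⇒InD : ∀ {A a c} → a ∈ A → c ∈ A → ¬ ((a ⊕ c) ∈2 (A without a)) →
    InD A (a ⊕ c)
  avoiding⇒InD {A} {a} {c} a∈A c∈A avoid = a , c , a∈A , c∈A , refl , unique
    where
    unique : ∀ b₁ b₂ → b₁ ∈ A → b₂ ∈ A → b₁ ⊕ b₂ ≡ a ⊕ c →
      (b₁ ≡ a × b₂ ≡ c) ⊎ (b₁ ≡ c × b₂ ≡ a)
    unique b₁ b₂ b₁∈A b₂∈A e with b₁ ≟ᵥ a | b₂ ≟ᵥ a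
    ... | yes refl | _       = inj₁ (refl , ⊕-cancelˡ a e)
    ... | no _     | yes refl = inj₂ (⊕-cancelˡ a (trans (⊕-comm a b₁) e) , refl)
    ... | no b₁≢a  | no b₂≢a  =
      ⊥-elim (avoid (b₁ , b₂ , ∈-without⁺ a b₁∈A b₁≢a , ∈-without⁺ a b₂∈A b₂≢a , e))

  removal-preserves-sumset : ∀ A a → (∀ {c} → c ∈ A → (a ⊕ c) ∈2 (A without a)) →
    ∀ y → y ∈2 (A without a) ⇔ y ∈2 A
  removal-preserves-sumset A a covered y = mk⇔ shrink grow
    where
    shrink : y ∈2 (A without a) → y ∈2 A
    shrink (x₁ , x₂ , x₁∈ , x₂∈ , e) =
      x₁ , x₂ , without-⊆ A a x₁∈ , without-⊆ A a x₂∈ , e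
    grow : y ∈2 A → y ∈2 (A without a)
    grow (x₁ , x₂ , x₁∈A , x₂∈A , e) with x₁ ≟ᵥ a | x₂ ≟ᵥ a
    ... | yes refl | _        = subst (_∈2 (A without a)) e (covered x₂∈A)
    ... | no _     | yes refl =
      subst (_∈2 (A without a)) (trans (⊕-comm a x₁) e) (covered x₁∈A)
    ... | no x₁≢a  | no x₂≢a  =
      x₁ , x₂ , ∈-without⁺ a x₁∈A x₁≢a , ∈-without⁺ a x₂∈A x₂≢a , e

  -- In a round set every element a has a partner c ∈ A with a + c ∈ D(A):
  -- otherwise A ∖ {a} would be a proper subset with the same sumset.
  round-partner : ∀ {A a} → Round A → a ∈ A → Σ (F2^ r) λ c → c ∈ A × InD A (a ⊕ c)
  round-partner {A} {a} round a∈A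
    with all? (λ c → (a ⊕ c) ∈2? (A without a)) A
  ... | yes covered =
    ⊥-elim (round (A without a) ((λ _ → without-⊆ A a) , a , a∈A , a∉A∖a)
                  (removal-preserves-sumset A a (All.lookup covered)))
    where
    a∉A∖a : a ∉ A without a
    a∉A∖a a∈ = proj₂ (∈-without⁻ A a a∈) refl
  ... | no ¬covered
    with find (¬All⇒Any¬ (λ c → (a ⊕ c) ∈2? (A without a)) A ¬covered)
  ... | c , c∈A , avoid = c , c∈A , avoiding⇒InD a∈A c∈A avoid

  round-hits : ∀ {A a} → Round A → a ∈ A → TwoToOne.HitsWithin _≟ᵥ_ (SummandOfD A) A a
  round-hits round a∈A with round-partner round a∈A
  ... | c , c∈A , inD =
    _ , (inD , c , c∈A , refl) , c ,
    λ z∈A (_ , z′ , z′∈A , e) → summand-of-InD inD a∈A c∈A refl z∈A z′∈A e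

corollary4p10 : (r : ℕ) → 1 ≤ r → (A : List (F2^ r)) → Unique A → Round A →
    Σ (List (F2^ r)) λ L → Unique L × (∀ y → y ∈ L → InD A y) × length A ≤ 2 * length L
corollary4p10 r _ A uniqueA round
  with TwoToOne.cover _≟ᵥ_ (SummandOfD A) A uniqueA (round-hits round)
... | L , uniqueL , hit , bound = L , uniqueL , inD , bound
  where
  inD : ∀ y → y ∈ L → InD A y
  inD y y∈L with hit y∈L
  ... | _ , _ , inDy , _ = inDy
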